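{- Let $f, g \colon X \to Y$ be morphisms in $\mathcal{OS}$ such that $X_{f,g} = \{x \in X : f(x) = g(x)\}$ is a subspace of $X$ and there is a Sasaki map from $X$ onto $X_{f,g}$. Then the inclusion map $\iota \colon X_{f,g} \to X$ is an equaliser of the pair $f, g$ in $\mathcal{OS}$.
   Context: An orthoset (with $0$) is a non-empty set $X$ with a binary relation $\perp$ and a distinguished element $0$ such that: $x\perp y$ implies $y\perp x$; $x\perp x$ iff $x=0$; $0\perp x$ for all $x$. For $A\subseteq X$, $A^\perp=\{x: x\perp y\ \forall y\in A\}$; a subspace is a set $A$ with $A=A^{\perp\perp}$; it contains $0$ and is an orthoset with the restricted relation. A map $f\colon X\to Y$ is adjointable if there is $g\colon Y\to X$ (an adjoint) with $f(x)\perp y\iff x\perp g(y)$ for all $x,y$. $\mathcal{OS}$ is the category of all orthosets and adjointable maps. For a subspace $A$ of $X$ with inclusion map $\iota\colon A\to X$, a Sasaki map onto $A$ is a map $\sigma\colon X\to A$ that is an adjoint of $\iota$, has kernel $\{x:\sigma(x)=0\}=A^\perp$, and satisfies $\sigma(a)=a$ for all $a\in A$ (i.e. $\sigma$ is a generalised inverse of the orthometry $\iota$). -}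

module Defs where

open import Level using (Level; suc; _⊔_)
open import Data.Product using (Σ; _×_; _,_; proj₁; proj₂)
open import Relation.Binary.PropositionalEquality using (_≡_; refl; sym; cong)
open import Relation.Unary using (Pred)
open import Axiom.UniquenessOfIdentityProofs.WithK using (uip)
open import Function.Bundles using (_⇔_; Equivalence)

-- An orthoset (with 0): carrier, symmetric orthogonality relation,
-- x ⊥ x iff x = 0 (the converse direction follows from 𝟎-⊥), and 0 ⊥ x for all x.
record Orthoset (a : Level) : Set (suc a) where
  field
    Carrier : Set a
    _⊥_     : Carrier → Carrier → Set a
    𝟎       : Carrier
    ⊥-sym   : ∀ {x y} → x ⊥ y → y ⊥ x
    ⊥-self  : ∀ x → x ⊥ x → x ≡ 𝟎
    𝟎-⊥     : ∀ x → 𝟎 ⊥ x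

open Orthoset public

IsAdjoint : ∀ {a} (X Y : Orthoset a) → (Carrier X → Carrier Y) → (Carrier Y → Carrier X) → Set a
IsAdjoint X Y f g = ∀ x y → (_⊥_ Y (f x) y ⇔ _⊥_ X x (g y))

IsAdjointable : ∀ {a} (X Y : Orthoset a) → (Carrier X → Carrier Y) → Set a
IsAdjointable X Y f = Σ (Carrier Y → Carrier X) (IsAdjoint X Y f)

record Hom {a} (X Y : Orthoset a) : Set a where
  constructor hom
  field
    ⟦_⟧        : Carrier X → Carrier Y
    adjointable : IsAdjointable X Y ⟦_⟧

open Hom public

module _ {a : Level} (X : Orthoset a) where
  private
    C = Carrier X
    _⊥'_ = _⊥_ X

  orth : Pred C a → Pred C a
  orth A x = ∀ y → A y → x ⊥' y

  IsSubspace : Pred C a → Set a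
  IsSubspace A = ∀ x → (A x ⇔ orth (orth A) x)

  subspace-𝟎 : (A : Pred C a) → IsSubspace A → A (𝟎 X)
  subspace-𝟎 A S = Equivalence.from (S (𝟎 X)) (λ y _ → 𝟎-⊥ X y)

  -- A subspace (a proposition-valued predicate, i.e. a subset), regarded as an
  -- orthoset with the restricted relation; its elements are pairs (x , x∈A).
  SubOrthoset : (A : Pred C a) → (∀ {x} (p q : A x) → p ≡ q) → IsSubspace A → Orthoset a
  SubOrthoset A irr S = record
    { Carrier = Σ C A
    ; _⊥_     = λ p q → proj₁ p ⊥' proj₁ q
    ; 𝟎       = (𝟎 X , subspace-𝟎 A S)
    ; ⊥-sym   = ⊥-sym X
    ; ⊥-self  = self
    ; 𝟎-⊥     = λ p → 𝟎-⊥ X (proj₁ p)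
    }
    where
    self : (p : Σ C A) → proj₁ p ⊥' proj₁ p → p ≡ (𝟎 X , subspace-𝟎 A S)
    self (x , ax) h with ⊥-self X x h
    ... | refl = cong (x ,_) (irr ax (subspace-𝟎 A S))

  incl : (A : Pred C a) → Σ C A → C
  incl A = proj₁

EqSet : ∀ {a} {X Y : Orthoset a} → Hom X Y → Hom X Y → Pred (Carrier X) a
EqSet f g x = ⟦ f ⟧ x ≡ ⟦ g ⟧ x

EqSet-irr : ∀ {a} {X Y : Orthoset a} (f g : Hom X Y) → ∀ {x} (p q : EqSet {X = X} {Y} f g x) → p ≡ q
EqSet-irr f g p q = uip p q

record IsSasakiMap {a} (X : Orthoset a) (A : Pred (Carrier X) a)
                   (irr : ∀ {x} (p q : A x) → p ≡ q) (S : IsSubspace X A)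
                   (σ : Carrier X → Carrier (SubOrthoset X A irr S)) : Set a where
  private
    XA = SubOrthoset X A irr S
  field
    adjoint : IsAdjoint XA X (incl X A) σ
    kernel  : ∀ x → (σ x ≡ 𝟎 XA ⇔ orth X A x)
    retract : ∀ (p : Carrier XA) → σ (incl X A p) ≡ p

-- Equaliser of f, g : X → Y in OS (morphism equality = equality of underlying
-- functions, stated pointwise since there is no function extensionality).
record IsEqualiser {a} {E X Y : Orthoset a} (f g : Hom X Y) (e : Hom E X) : Set (suc a) where
  field
    equalises : ∀ z → ⟦ f ⟧ (⟦ e ⟧ z) ≡ ⟦ g ⟧ (⟦ e ⟧ z)
    factor    : ∀ (Z : Orthoset a) (h : Hom Z X) →
                (∀ z → ⟦ f ⟧ (⟦ h ⟧ z) ≡ ⟦ g ⟧ (⟦ h ⟧ z)) →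
                Σ (Hom Z E) λ k →
                  (∀ z → ⟦ e ⟧ (⟦ k ⟧ z) ≡ ⟦ h ⟧ z) ×
                  (∀ (k′ : Hom Z E) → (∀ z → ⟦ e ⟧ (⟦ k′ ⟧ z) ≡ ⟦ h ⟧ z) → ∀ z → ⟦ k′ ⟧ z ≡ ⟦ k ⟧ z)

-- A morphism h : Z → X with f ∘ h = g ∘ h lands in X_{f,g}, so it corestricts to
-- k : Z → X_{f,g}; k is adjointable with adjoint h* ∘ ι, and it is the unique
-- factorisation because ι is injective. The Sasaki map is needed only for the
-- adjoint of ι itself, which makes ι a morphism of OS.
module Submission where

open import Defs
open import Level using (Level)
open import Data.Product using (Σ; _,_; proj₁; proj₂)
open import Relation.Binary.PropositionalEquality using (_≡_; refl; cong)
open import Relation.Unary using (Pred)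
open import Function using (_∘_)

module Subspace {a : Level} (X : Orthoset a) (A : Pred (Carrier X) a)
                (irr : ∀ {x} (p q : A x) → p ≡ q) (S : IsSubspace X A) where

  private
    XA = SubOrthoset X A irr S

  incl-injective : ∀ {p q : Carrier XA} → incl X A p ≡ incl X A q → p ≡ q
  incl-injective {x , ax} {.x , ax′} refl = cong (x ,_) (irr ax ax′)

  corestrict : {Z : Orthoset a} (h : Hom Z X) → (∀ z → A (⟦ h ⟧ z)) → Hom Z XA
  corestrict {Z} h h∈A = hom (λ z → ⟦ h ⟧ z , h∈A z) (h* ∘ incl X A , λ z p → h*-adjoint z (proj₁ p))
    where
    h* : Carrier X → Carrier Z
    h* = proj₁ (adjointable h)

    h*-adjoint : IsAdjoint Z X ⟦ h ⟧ h*
    h*-adjoint = proj₂ (adjointable h)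

proposition5p5 : ∀ {a : Level} (X Y : Orthoset a) (f g : Hom X Y)
    → (S : IsSubspace X (EqSet f g))
    → Σ (Carrier X → Carrier (SubOrthoset X (EqSet f g) (EqSet-irr f g) S))
        (IsSasakiMap X (EqSet f g) (EqSet-irr f g) S)
    → Σ (IsAdjointable (SubOrthoset X (EqSet f g) (EqSet-irr f g) S) X (incl X (EqSet f g)))
        λ adj → IsEqualiser {E = SubOrthoset X (EqSet f g) (EqSet-irr f g) S} f g (hom (incl X (EqSet f g)) adj)
proposition5p5 X Y f g S (σ , sasaki) = (σ , IsSasakiMap.adjoint sasaki) , record
  { equalises = proj₂
  ; factor    = λ Z h fh≡gh →
      corestrict h fh≡gh
      , (λ z → refl)
      , λ k′ ιk′≡h z → incl-injective (ιk′≡h z)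
  }
  where open Subspace X (EqSet f g) (EqSet-irr f g) S
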